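{- Let $R$ be an integral domain and let $I$ be an ideal of $R$. If $|I|\ge 3$, then $\mathrm{girth}(\Gamma(R\Join I))=4$. If $|I|=2$, then $I=R\cong\mathbb Z_2$ and $\mathrm{girth}(\Gamma(R\Join I))=\infty$.
   Context: $R\Join I=\{(r,r+i)\mid r\in R,\ i\in I\}$ is the subring of $R\times R$ (componentwise operations), called the amalgamated duplication of $R$ along $I$. For a commutative ring $A$, $\Gamma(A)$ is the zero-divisor graph: its vertices are the non-zero zero-divisors of $A$, and distinct vertices $x,y$ are adjacent iff $xy=0$. The girth of a graph is the length of a shortest cycle, and is $\infty$ if there is no cycle. -}

module Defs where

open import Level using (Level; _⊔_)
open import Algebra.Bundles using (CommutativeRing; RawRing)
import Data.Nat
open import Data.Nat using (ℕ; _≤_)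
open import Data.Empty using (⊥)
open import Data.Fin using (Fin; zero; suc; inject₁; fromℕ)
open import Data.Product using (_×_; ∃; Σ)
open import Data.Sum using (_⊎_)
open import Relation.Nullary using (¬_)
open import Relation.Binary.Core using (Rel)
open import Relation.Binary.PropositionalEquality using (_≡_)

record Ideal {c ℓ} (R : CommutativeRing c ℓ) (p : Level) : Set (c ⊔ ℓ ⊔ Level.suc p) where
  open CommutativeRing R
  field
    _∈I     : Carrier → Set p
    respects : ∀ {x y} → x ≈ y → x ∈I → y ∈I
    0∈I      : 0# ∈I
    +-closed : ∀ {x y} → x ∈I → y ∈I → (x + y) ∈I
    *-closed : ∀ r {x} → x ∈I → (r * x) ∈I

  *-closedʳ : ∀ {x} → x ∈I → ∀ r → (x * r) ∈I
  *-closedʳ {x} x∈ r = respects (*-comm r x) (*-closed r x∈)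

record IsIntegralDomain {c ℓ} (R : CommutativeRing c ℓ) : Set (c ⊔ ℓ) where
  open CommutativeRing R
  field
    1≉0          : ¬ (1# ≈ 0#)
    no-zero-divs : ∀ a b → a * b ≈ 0# → (a ≈ 0#) ⊎ (b ≈ 0#)

module ZeroDivisorGraph {a l} {A : Set a} (_≈_ : Rel A l) (0# : A) (_*_ : A → A → A) where

  IsVertex : A → Set (a ⊔ l)
  IsVertex x = ¬ (x ≈ 0#) × ∃ λ y → ¬ (y ≈ 0#) × ((x * y) ≈ 0#)

  Adjacent : A → A → Set (a ⊔ l)
  Adjacent x y = IsVertex x × IsVertex y × ¬ (x ≈ y) × ((x * y) ≈ 0#)

  -- A cycle of length (suc k) ≥ 3: pairwise distinct vertices
  -- v 0, v 1, …, v k with v i ~ v (i+1) and v k ~ v 0.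
  record Cycle (k : ℕ) : Set (a ⊔ l) where
    field
      length≥3 : 2 ≤ k
      vertex   : Fin (Data.Nat.suc k) → A
      distinct : ∀ i j → vertex i ≈ vertex j → i ≡ j
      step     : ∀ (i : Fin k) → Adjacent (vertex (inject₁ i)) (vertex (suc i))
      close    : Adjacent (vertex (fromℕ k)) (vertex zero)

  -- girth = length of a shortest cycle (cycles have length ≥ 3)
  -- girth = 4 : a cycle of length 4 exists, none of length 3
  GirthIs4 : Set (a ⊔ l)
  GirthIs4 = Cycle 3 × ¬ Cycle 2

  GirthIsInfinite : Set (a ⊔ l)
  GirthIsInfinite = ∀ k → ¬ Cycle k

-- The amalgamated duplication R ⋈ I = {(r , r + i) | r ∈ R, i ∈ I},
-- a subring of R × R with componentwise operations.
-- An element is stored as r and i ∈ I; it denotes the pair (r , r + i).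

module AmalgamatedDuplication {c ℓ p} (R : CommutativeRing c ℓ) (I : Ideal R p) where
  open CommutativeRing R
  open Ideal I

  record R⋈I : Set (c ⊔ p) where
    constructor ⟨_,_,_⟩
    field
      r   : Carrier
      i   : Carrier
      i∈I : i ∈I

  fst : R⋈I → Carrier
  fst x = R⋈I.r x

  snd : R⋈I → Carrier
  snd x = R⋈I.r x + R⋈I.i x

  _≈⋈_ : Rel R⋈I ℓ
  x ≈⋈ y = (fst x ≈ fst y) × (snd x ≈ snd y)

  0⋈ : R⋈I
  0⋈ = ⟨ 0# , 0# , 0∈I ⟩

  -- componentwise product: (r , r + i) (s , s + j) = (r s , (r + i)(s + j));
  -- the second coordinate is represented as  r s + (r j + i (s + j)),
  -- which equals (r + i)(s + j) in R.
  _*⋈_ : R⋈I → R⋈I → R⋈I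
  ⟨ r₁ , i₁ , p₁ ⟩ *⋈ ⟨ r₂ , i₂ , p₂ ⟩ =
    ⟨ r₁ * r₂ , r₁ * i₂ + i₁ * (r₂ + i₂) , +-closed (*-closed r₁ p₂) (*-closedʳ p₁ (r₂ + i₂)) ⟩

  module Γ = ZeroDivisorGraph _≈⋈_ 0⋈ _*⋈_

-- A vertex of Γ(R ⋈ I) is a nonzero pair with a zero-divisor partner; since R is a
-- domain, exactly one of its coordinates vanishes, so it lies on one of the two axes
-- (r , 0) or (0 , s), and two vertices can only be adjacent if they lie on opposite
-- axes. Hence Γ(R ⋈ I) is bipartite and has no triangle. Every nonzero a ∈ I gives
-- the vertices (a , 0) and (0 , a), joined by an edge, so two distinct nonzero elements
-- of I (the differences x - y and x - z of three distinct ones) give a 4-cycle.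
-- If I = {0 , a} with a ≠ 0, then a² ∈ I is nonzero, so a² = a and a = 1; thus
-- I = R = {0 , 1} ≅ ℤ₂ and each axis carries a single vertex, so there is no cycle.
module Submission where

open import Defs
open import Level using (Level; _⊔_)
open import Algebra.Bundles using (CommutativeRing)
open import Algebra.Morphism.Structures using (module RingMorphisms)
open import Data.Bool.Properties using (xor-∧-commutativeRing)
open import Data.Product using (_×_; ∃; ∃-syntax)
open import Data.Sum using (_⊎_)
open import Relation.Nullary using (¬_)

open import Algebra.Definitions using (Congruent₂)
open import Data.Bool using (Bool; true; false; _xor_; _∧_)
open import Data.Empty using (⊥; ⊥-elim)
open import Data.Fin using (Fin; inject₁)
open import Data.Fin.Patterns using (0F; 1F; 2F; 3F)
open import Data.Nat using (suc; s≤s; z≤n)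
open import Data.Product using (_,_; proj₁; proj₂)
open import Data.Sum using (inj₁; inj₂; [_,_]′; fromInj₁; fromInj₂; map₁; map₂; swap)
open import Function using (_∘_; const)
open import Relation.Binary.PropositionalEquality as ≡ using (_≡_; subst)

data Axis : Set where
  first second : Axis

opposite : Axis → Axis
opposite first  = second
opposite second = first

opposite-involutive : ∀ s → opposite (opposite s) ≡ s
opposite-involutive first  = ≡.refl
opposite-involutive second = ≡.refl

module _ {c ℓ} (R : CommutativeRing c ℓ) where
  open CommutativeRing R

  module TwoElementRing (1≉0 : ¬ 1# ≈ 0#) (≈0⊎≈1 : ∀ r → r ≈ 0# ⊎ r ≈ 1#) where
    open import Algebra.Properties.Ring ring using (+-cancelˡ; +-inverseʳ-unique)
    open RingMorphisms rawRing (CommutativeRing.rawRing xor-∧-commutativeRing)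

    1+1≈0 : 1# + 1# ≈ 0#
    1+1≈0 with ≈0⊎≈1 (1# + 1#)
    ... | inj₁ 1+1≈0 = 1+1≈0
    ... | inj₂ 1+1≈1 = ⊥-elim (1≉0 (+-cancelˡ 1# 1# 0# (trans 1+1≈1 (sym (+-identityʳ 1#)))))

    toBool : Carrier → Bool
    toBool r = [ const false , const true ]′ (≈0⊎≈1 r)

    fromBool : Bool → Carrier
    fromBool false = 0#
    fromBool true  = 1#

    toBool-≈0 : ∀ {r} → r ≈ 0# → toBool r ≡ false
    toBool-≈0 {r} r≈0 with ≈0⊎≈1 r
    ... | inj₁ _   = ≡.refl
    ... | inj₂ r≈1 = ⊥-elim (1≉0 (trans (sym r≈1) r≈0))

    toBool-≈1 : ∀ {r} → r ≈ 1# → toBool r ≡ true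
    toBool-≈1 {r} r≈1 with ≈0⊎≈1 r
    ... | inj₁ r≈0 = ⊥-elim (1≉0 (trans (sym r≈1) r≈0))
    ... | inj₂ _   = ≡.refl

    toBool-cong : ∀ {r s} → r ≈ s → toBool r ≡ toBool s
    toBool-cong {r} r≈s with ≈0⊎≈1 r
    ... | inj₁ r≈0 = ≡.sym (toBool-≈0 (trans (sym r≈s) r≈0))
    ... | inj₂ r≈1 = ≡.sym (toBool-≈1 (trans (sym r≈s) r≈1))

    toBool-fromBool : ∀ b → toBool (fromBool b) ≡ b
    toBool-fromBool false = toBool-≈0 refl
    toBool-fromBool true  = toBool-≈1 refl

    fromBool-toBool : ∀ r → fromBool (toBool r) ≈ r
    fromBool-toBool r with ≈0⊎≈1 r
    ... | inj₁ r≈0 = sym r≈0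
    ... | inj₂ r≈1 = sym r≈1

    fromBool-xor : ∀ b b′ → fromBool (b xor b′) ≈ fromBool b + fromBool b′
    fromBool-xor false b′    = sym (+-identityˡ _)
    fromBool-xor true  false = sym (+-identityʳ 1#)
    fromBool-xor true  true  = sym 1+1≈0

    fromBool-∧ : ∀ b b′ → fromBool (b ∧ b′) ≈ fromBool b * fromBool b′
    fromBool-∧ false b′ = sym (zeroˡ _)
    fromBool-∧ true  b′ = sym (*-identityˡ _)

    -fromBool≈fromBool : ∀ b → - fromBool b ≈ fromBool b
    -fromBool≈fromBool b = sym (+-inverseʳ-unique (fromBool b) (fromBool b) (fromBool-b+b≈0 b))
      where
      fromBool-b+b≈0 : ∀ b → fromBool b + fromBool b ≈ 0#
      fromBool-b+b≈0 false = +-identityʳ 0#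
      fromBool-b+b≈0 true  = 1+1≈0

    toBool-homo₂ : ∀ {_∙_ : Carrier → Carrier → Carrier} {_∘_ : Bool → Bool → Bool} →
                   Congruent₂ _≈_ _∙_ → (∀ b b′ → fromBool (b ∘ b′) ≈ fromBool b ∙ fromBool b′) →
                   ∀ r s → toBool (r ∙ s) ≡ toBool r ∘ toBool s
    toBool-homo₂ {_∙_} {_∘_} ∙-cong fromBool-homo r s = begin
      toBool (r ∙ s)                                       ≡⟨ toBool-cong (∙-cong (sym (fromBool-toBool r)) (sym (fromBool-toBool s))) ⟩
      toBool (fromBool (toBool r) ∙ fromBool (toBool s))   ≡⟨ toBool-cong (sym (fromBool-homo (toBool r) (toBool s))) ⟩
      toBool (fromBool (toBool r ∘ toBool s))              ≡⟨ toBool-fromBool (toBool r ∘ toBool s) ⟩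
      toBool r ∘ toBool s                                  ∎
      where open ≡.≡-Reasoning

    toBool-neg : ∀ r → toBool (- r) ≡ toBool r
    toBool-neg r = begin
      toBool (- r)                    ≡⟨ toBool-cong (-‿cong (sym (fromBool-toBool r))) ⟩
      toBool (- fromBool (toBool r))  ≡⟨ toBool-cong (-fromBool≈fromBool (toBool r)) ⟩
      toBool (fromBool (toBool r))    ≡⟨ toBool-fromBool (toBool r) ⟩
      toBool r                        ∎
      where open ≡.≡-Reasoning

    toBool-injective : ∀ {r s} → toBool r ≡ toBool s → r ≈ s
    toBool-injective {r} {s} e = begin
      r                   ≈⟨ sym (fromBool-toBool r) ⟩
      fromBool (toBool r) ≡⟨ ≡.cong fromBool e ⟩
      fromBool (toBool s) ≈⟨ fromBool-toBool s ⟩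
      s                   ∎
      where open import Relation.Binary.Reasoning.Setoid setoid

    toBool-isRingIsomorphism : IsRingIsomorphism toBool
    toBool-isRingIsomorphism = record
      { isRingMonomorphism = record
        { isRingHomomorphism = record
          { isSemiringHomomorphism = record
            { isNearSemiringHomomorphism = record
              { +-isMonoidHomomorphism = record
                { isMagmaHomomorphism = record
                  { isRelHomomorphism = record { cong = toBool-cong }
                  ; homo = toBool-homo₂ {_+_} {_xor_} +-cong fromBool-xor
                  }
                ; ε-homo = toBool-≈0 refl
                }
              ; *-homo = toBool-homo₂ {_*_} {_∧_} *-cong fromBool-∧
              }
            ; 1#-homo = toBool-≈1 refl
            }
          ; -‿homo = toBool-neg
          }
        ; injective = toBool-injective
        }
      ; surjective = λ b → fromBool b , λ z≈b → ≡.trans (toBool-cong z≈b) (toBool-fromBool b)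
      }

  module IntegralDomainProperties (D : IsIntegralDomain R) where
    open IsIntegralDomain D
    open import Algebra.Properties.Ring ring using (-‿distribʳ-*; x∙y⁻¹≈ε⇒x≈y)
    open import Relation.Binary.Reasoning.Setoid setoid

    x*y≈0∧x≉0⇒y≈0 : ∀ {x y} → x * y ≈ 0# → ¬ x ≈ 0# → y ≈ 0#
    x*y≈0∧x≉0⇒y≈0 {x} {y} xy≈0 x≉0 = fromInj₂ (⊥-elim ∘ x≉0) (no-zero-divs x y xy≈0)

    x*y≈0∧y≉0⇒x≈0 : ∀ {x y} → x * y ≈ 0# → ¬ y ≈ 0# → x ≈ 0#
    x*y≈0∧y≉0⇒x≈0 {x} {y} xy≈0 y≉0 = fromInj₁ (⊥-elim ∘ y≉0) (no-zero-divs x y xy≈0)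

    x≉0⇒x*x≉0 : ∀ {x} → ¬ x ≈ 0# → ¬ x * x ≈ 0#
    x≉0⇒x*x≉0 x≉0 xx≈0 = x≉0 (x*y≈0∧x≉0⇒y≈0 xx≈0 x≉0)

    x*x≈x∧x≉0⇒x≈1 : ∀ {x} → x * x ≈ x → ¬ x ≈ 0# → x ≈ 1#
    x*x≈x∧x≉0⇒x≈1 {x} xx≈x x≉0 = x∙y⁻¹≈ε⇒x≈y x 1# (x*y≈0∧x≉0⇒y≈0 x[x-1]≈0 x≉0)
      where
      x[x-1]≈0 : x * (x - 1#) ≈ 0#
      x[x-1]≈0 = begin
        x * (x - 1#)       ≈⟨ distribˡ x x (- 1#) ⟩
        x * x + x * - 1#   ≈⟨ +-cong xx≈x (sym (-‿distribʳ-* x 1#)) ⟩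
        x - x * 1#         ≈⟨ +-congˡ (-‿cong (*-identityʳ x)) ⟩
        x - x              ≈⟨ -‿inverseʳ x ⟩
        0#                 ∎

  module IdealProperties {p} (I : Ideal R p) where
    open Ideal I
    open import Algebra.Properties.Ring ring using (-1*x≈-x)

    -‿closed : ∀ {x} → x ∈I → (- x) ∈I
    -‿closed {x} x∈I = respects (-1*x≈-x x) (*-closed (- 1#) x∈I)

    two-element⇒⊆[0,a] : (∃[ x ] ∃[ y ] (x ∈I × y ∈I × ¬ (x ≈ y) × (∀ z → z ∈I → (z ≈ x) ⊎ (z ≈ y)))) →
                         ∃[ a ] (a ∈I × ¬ a ≈ 0# × (∀ z → z ∈I → z ≈ 0# ⊎ z ≈ a))
    two-element⇒⊆[0,a] (x , y , x∈I , y∈I , x≉y , cover) with cover 0# 0∈I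
    ... | inj₁ 0≈x = y , y∈I , (λ y≈0 → x≉y (trans (sym 0≈x) (sym y≈0))) ,
                     λ z z∈I → map₁ (λ z≈x → trans z≈x (sym 0≈x)) (cover z z∈I)
    ... | inj₂ 0≈y = x , x∈I , (λ x≈0 → x≉y (trans x≈0 0≈y)) ,
                     λ z z∈I → swap (map₂ (λ z≈y → trans z≈y (sym 0≈y)) (cover z z∈I))

    module _ (D : IsIntegralDomain R) where
      open IntegralDomainProperties D

      ⊆[0,a]⇒a≈1 : ∀ {a} → a ∈I → ¬ a ≈ 0# → (∀ z → z ∈I → z ≈ 0# ⊎ z ≈ a) → a ≈ 1#
      ⊆[0,a]⇒a≈1 {a} a∈I a≉0 ⊆[0,a] = x*x≈x∧x≉0⇒x≈1 a*a≈a a≉0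
        where
        a*a≈a : a * a ≈ a
        a*a≈a = fromInj₂ (⊥-elim ∘ x≉0⇒x*x≉0 a≉0) (⊆[0,a] (a * a) (*-closed a a∈I))

module DuplicationProperties {c ℓ p} (R : CommutativeRing c ℓ) (I : Ideal R p) where
  open CommutativeRing R
  open Ideal I
  open AmalgamatedDuplication R I
  open import Relation.Binary.Reasoning.Setoid setoid
  open IdealProperties R I

  ≈⋈-sym : ∀ {u v} → u ≈⋈ v → v ≈⋈ u
  ≈⋈-sym (fst≈ , snd≈) = sym fst≈ , sym snd≈

  snd-*⋈ : ∀ u v → snd (u *⋈ v) ≈ snd u * snd v
  snd-*⋈ ⟨ r , i , _ ⟩ ⟨ s , j , _ ⟩ = begin
    r * s + (r * j + i * (s + j)) ≈⟨ sym (+-assoc _ _ _) ⟩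
    (r * s + r * j) + i * (s + j) ≈⟨ +-congʳ (sym (distribˡ r s j)) ⟩
    r * (s + j) + i * (s + j)     ≈⟨ sym (distribʳ (s + j) r i) ⟩
    (r + i) * (s + j)             ∎

  ≈0⋈-intro : ∀ u → fst u ≈ 0# → snd u ≈ 0# → u ≈⋈ 0⋈
  ≈0⋈-intro _ fst≈0 snd≈0 = fst≈0 , trans snd≈0 (sym (+-identityʳ 0#))

  ≈0⋈⇒snd≈0 : ∀ u → u ≈⋈ 0⋈ → snd u ≈ 0#
  ≈0⋈⇒snd≈0 _ (_ , snd≈0+0) = trans snd≈0+0 (+-identityʳ 0#)

  *⋈≈0⋈⇒ : ∀ u v → (u *⋈ v) ≈⋈ 0⋈ → fst u * fst v ≈ 0# × snd u * snd v ≈ 0#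
  *⋈≈0⋈⇒ u v uv≈0 = proj₁ uv≈0 , trans (sym (snd-*⋈ u v)) (≈0⋈⇒snd≈0 (u *⋈ v) uv≈0)

  *⋈≈0⋈⇐ : ∀ u v → fst u * fst v ≈ 0# → snd u * snd v ≈ 0# → (u *⋈ v) ≈⋈ 0⋈
  *⋈≈0⋈⇐ u v fst≈0 snd≈0 = ≈0⋈-intro (u *⋈ v) fst≈0 (trans (snd-*⋈ u v) snd≈0)

  data OnAxis : Axis → R⋈I → Set (c ⊔ ℓ ⊔ p) where
    onFirst  : ∀ {u} → ¬ fst u ≈ 0# → snd u ≈ 0# → OnAxis first u
    onSecond : ∀ {u} → fst u ≈ 0# → ¬ snd u ≈ 0# → OnAxis second u

  -- ⟨ r , i , _ ⟩ denotes (r , r + i), so these are the pairs (a , 0) and (0 , a).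
  axisPoint : Axis → ∀ {a} → a ∈I → R⋈I
  axisPoint first  {a} a∈I = ⟨ a , - a , -‿closed a∈I ⟩
  axisPoint second {a} a∈I = ⟨ 0# , a , a∈I ⟩

  axisPoint-onAxis : ∀ s {a} (a∈I : a ∈I) → ¬ a ≈ 0# → OnAxis s (axisPoint s a∈I)
  axisPoint-onAxis first  {a} _ a≉0 = onFirst a≉0 (-‿inverseʳ a)
  axisPoint-onAxis second {a} _ a≉0 = onSecond refl (a≉0 ∘ trans (sym (+-identityˡ a)))

  axisPoint-injective : ∀ s {a b} (a∈I : a ∈I) (b∈I : b ∈I) →
                        axisPoint s a∈I ≈⋈ axisPoint s b∈I → a ≈ b
  axisPoint-injective first  _ _ (a≈b , _) = a≈b
  axisPoint-injective second {a} {b} _ _ (_ , 0+a≈0+b) = begin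
    a      ≈⟨ sym (+-identityˡ a) ⟩
    0# + a ≈⟨ 0+a≈0+b ⟩
    0# + b ≈⟨ +-identityˡ b ⟩
    b      ∎

  onAxis⇒≉0⋈ : ∀ {s u} → OnAxis s u → ¬ u ≈⋈ 0⋈
  onAxis⇒≉0⋈         (onFirst fst≉0 _)  u≈0 = fst≉0 (proj₁ u≈0)
  onAxis⇒≉0⋈ {u = u} (onSecond _ snd≉0) u≈0 = snd≉0 (≈0⋈⇒snd≈0 u u≈0)

  onOppositeAxes⇒≉ : ∀ {s u v} → OnAxis s u → OnAxis (opposite s) v → ¬ u ≈⋈ v
  onOppositeAxes⇒≉ (onFirst fst-u≉0 _)  (onSecond fst-v≈0 _) (fst≈ , _) = fst-u≉0 (trans fst≈ fst-v≈0)
  onOppositeAxes⇒≉ (onSecond _ snd-u≉0) (onFirst _ snd-v≈0)  (_ , snd≈) = snd-u≉0 (trans snd≈ snd-v≈0)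

  onOppositeAxes⇒*⋈≈0⋈ : ∀ {s u v} → OnAxis s u → OnAxis (opposite s) v → (u *⋈ v) ≈⋈ 0⋈
  onOppositeAxes⇒*⋈≈0⋈ {u = u} {v} (onFirst _ snd-u≈0) (onSecond fst-v≈0 _) =
    *⋈≈0⋈⇐ u v (trans (*-congˡ fst-v≈0) (zeroʳ _)) (trans (*-congʳ snd-u≈0) (zeroˡ _))
  onOppositeAxes⇒*⋈≈0⋈ {u = u} {v} (onSecond fst-u≈0 _) (onFirst _ snd-v≈0) =
    *⋈≈0⋈⇐ u v (trans (*-congʳ fst-u≈0) (zeroˡ _)) (trans (*-congˡ snd-v≈0) (zeroʳ _))

  onAxis-opposite² : ∀ {s u} → OnAxis s u → OnAxis (opposite (opposite s)) u
  onAxis-opposite² {s} {u} = subst (λ t → OnAxis t u) (≡.sym (opposite-involutive s))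

  open Γ

  onOppositeAxes⇒adjacent : ∀ {s u v} → OnAxis s u → OnAxis (opposite s) v → Adjacent u v
  onOppositeAxes⇒adjacent {u = u} {v} u∈s v∈s′ =
    (u≉0 , v , v≉0 , uv≈0) , (v≉0 , u , u≉0 , vu≈0) , onOppositeAxes⇒≉ u∈s v∈s′ , uv≈0
    where
    u≉0 : ¬ u ≈⋈ 0⋈
    u≉0 = onAxis⇒≉0⋈ u∈s
    v≉0 : ¬ v ≈⋈ 0⋈
    v≉0 = onAxis⇒≉0⋈ v∈s′
    uv≈0 : (u *⋈ v) ≈⋈ 0⋈
    uv≈0 = onOppositeAxes⇒*⋈≈0⋈ u∈s v∈s′
    vu≈0 : (v *⋈ u) ≈⋈ 0⋈
    vu≈0 = onOppositeAxes⇒*⋈≈0⋈ v∈s′ (onAxis-opposite² u∈s)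

  square : ∀ {u u′ v v′} → OnAxis first u → OnAxis first u′ → ¬ u ≈⋈ u′ →
           OnAxis second v → OnAxis second v′ → ¬ v ≈⋈ v′ → Cycle 3
  square {u} {u′} {v} {v′} u∈ u′∈ u≉u′ v∈ v′∈ v≉v′ = record
    { length≥3 = s≤s (s≤s z≤n)
    ; vertex   = vertex
    ; distinct = distinct
    ; step     = step
    ; close    = onOppositeAxes⇒adjacent v′∈ u∈
    }
    where
    vertex : Fin 4 → R⋈I
    vertex 0F = u
    vertex 1F = v
    vertex 2F = u′
    vertex 3F = v′

    step : ∀ i → Adjacent (vertex (inject₁ i)) (vertex (Fin.suc i))
    step 0F = onOppositeAxes⇒adjacent u∈ v∈
    step 1F = onOppositeAxes⇒adjacent v∈ u′∈
    step 2F = onOppositeAxes⇒adjacent u′∈ v′∈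

    distinct : ∀ i j → vertex i ≈⋈ vertex j → i ≡ j
    distinct 0F 0F _ = ≡.refl
    distinct 0F 1F e = ⊥-elim (onOppositeAxes⇒≉ u∈ v∈ e)
    distinct 0F 2F e = ⊥-elim (u≉u′ e)
    distinct 0F 3F e = ⊥-elim (onOppositeAxes⇒≉ u∈ v′∈ e)
    distinct 1F 0F e = ⊥-elim (onOppositeAxes⇒≉ v∈ u∈ e)
    distinct 1F 1F _ = ≡.refl
    distinct 1F 2F e = ⊥-elim (onOppositeAxes⇒≉ v∈ u′∈ e)
    distinct 1F 3F e = ⊥-elim (v≉v′ e)
    distinct 2F 0F e = ⊥-elim (u≉u′ (≈⋈-sym {u′} {u} e))
    distinct 2F 1F e = ⊥-elim (onOppositeAxes⇒≉ u′∈ v∈ e)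
    distinct 2F 2F _ = ≡.refl
    distinct 2F 3F e = ⊥-elim (onOppositeAxes⇒≉ u′∈ v′∈ e)
    distinct 3F 0F e = ⊥-elim (onOppositeAxes⇒≉ v′∈ u∈ e)
    distinct 3F 1F e = ⊥-elim (v≉v′ (≈⋈-sym {v′} {v} e))
    distinct 3F 2F e = ⊥-elim (onOppositeAxes⇒≉ v′∈ u′∈ e)
    distinct 3F 3F _ = ≡.refl

  two-nonzero⇒square : ∀ {a b} → a ∈I → b ∈I → ¬ a ≈ 0# → ¬ b ≈ 0# → ¬ a ≈ b → Cycle 3
  two-nonzero⇒square a∈I b∈I a≉0 b≉0 a≉b =
    square (axisPoint-onAxis first a∈I a≉0) (axisPoint-onAxis first b∈I b≉0) (a≉b ∘ axisPoint-injective first a∈I b∈I)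
           (axisPoint-onAxis second a∈I a≉0) (axisPoint-onAxis second b∈I b≉0) (a≉b ∘ axisPoint-injective second a∈I b∈I)

module DuplicationOfDomain {c ℓ p} (R : CommutativeRing c ℓ) (D : IsIntegralDomain R) (I : Ideal R p) where
  open CommutativeRing R
  open IsIntegralDomain D
  open Ideal I
  open AmalgamatedDuplication R I
  open Γ
  open IntegralDomainProperties R D
  open IdealProperties R I
  open DuplicationProperties R I
  open import Algebra.Properties.Ring ring using (x∙y⁻¹≈ε⇒x≈y; +-cancelˡ; -‿injective)

  vertex⇒onAxis : ∀ u → IsVertex u → ∃ λ s → OnAxis s u
  vertex⇒onAxis u (u≉0 , v , v≉0 , uv≈0) with no-zero-divs (fst u) (fst v) (proj₁ uv≈0)
  ... | inj₁ fst-u≈0 = second , onSecond fst-u≈0 (u≉0 ∘ ≈0⋈-intro u fst-u≈0)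
  ... | inj₂ fst-v≈0 = first , onFirst (λ fst-u≈0 → u≉0 (≈0⋈-intro u fst-u≈0 snd-u≈0)) snd-u≈0
    where
    snd-u≈0 : snd u ≈ 0#
    snd-u≈0 = x*y≈0∧y≉0⇒x≈0 (proj₂ (*⋈≈0⋈⇒ u v uv≈0)) (v≉0 ∘ ≈0⋈-intro v fst-v≈0)

  annihilator-onOppositeAxis : ∀ {s u v} → OnAxis s u → ¬ v ≈⋈ 0⋈ → (u *⋈ v) ≈⋈ 0⋈ →
                               OnAxis (opposite s) v
  annihilator-onOppositeAxis {u = u} {v} (onFirst fst-u≉0 _) v≉0 uv≈0 =
    onSecond fst-v≈0 (v≉0 ∘ ≈0⋈-intro v fst-v≈0)
    where
    fst-v≈0 : fst v ≈ 0#
    fst-v≈0 = x*y≈0∧x≉0⇒y≈0 (proj₁ (*⋈≈0⋈⇒ u v uv≈0)) fst-u≉0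
  annihilator-onOppositeAxis {u = u} {v} (onSecond _ snd-u≉0) v≉0 uv≈0 =
    onFirst (λ fst-v≈0 → v≉0 (≈0⋈-intro v fst-v≈0 snd-v≈0)) snd-v≈0
    where
    snd-v≈0 : snd v ≈ 0#
    snd-v≈0 = x*y≈0∧x≉0⇒y≈0 (proj₂ (*⋈≈0⋈⇒ u v uv≈0)) snd-u≉0

  adjacent⇒onOppositeAxis : ∀ {s} u v → OnAxis s u → Adjacent u v → OnAxis (opposite s) v
  adjacent⇒onOppositeAxis _ _ u∈s (_ , (v≉0 , _) , _ , uv≈0) = annihilator-onOppositeAxis u∈s v≉0 uv≈0

  path⇒onSameAxis : ∀ {s} u v w → OnAxis s u → Adjacent u v → Adjacent v w → OnAxis s w
  path⇒onSameAxis {s} u v w u∈s uv vw =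
    subst (λ t → OnAxis t w) (opposite-involutive s)
          (adjacent⇒onOppositeAxis v w (adjacent⇒onOppositeAxis u v u∈s uv) vw)

  no-triangle : ∀ u v w → Adjacent u v → Adjacent v w → Adjacent w u → ⊥
  no-triangle u v w uv vw wu =
    let s , u∈s = vertex⇒onAxis u (proj₁ uv)
    in onOppositeAxes⇒≉ u∈s (adjacent⇒onOppositeAxis w u (path⇒onSameAxis u v w u∈s uv vw) wu) (refl , refl)

  ¬cycle₃ : ¬ Cycle 2
  ¬cycle₃ C = no-triangle (vertex 0F) (vertex 1F) (vertex 2F) (step 0F) (step 1F) close
    where open Cycle C

  three-distinct⇒girth≡4 : (∃[ x ] ∃[ y ] ∃[ z ] (x ∈I × y ∈I × z ∈I × ¬ (x ≈ y) × ¬ (x ≈ z) × ¬ (y ≈ z))) →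
                           GirthIs4
  three-distinct⇒girth≡4 (x , y , z , x∈I , y∈I , z∈I , x≉y , x≉z , y≉z) =
    two-nonzero⇒square (+-closed x∈I (-‿closed y∈I)) (+-closed x∈I (-‿closed z∈I))
                       (x≉y ∘ x∙y⁻¹≈ε⇒x≈y x y) (x≉z ∘ x∙y⁻¹≈ε⇒x≈y x z)
                       (y≉z ∘ -‿injective ∘ +-cancelˡ x (- y) (- z)) ,
    ¬cycle₃

  module _ (≈0⊎≈1 : ∀ r → r ≈ 0# ⊎ r ≈ 1#) where

    ≉0⇒≈1 : ∀ {r} → ¬ r ≈ 0# → r ≈ 1#
    ≉0⇒≈1 {r} r≉0 = fromInj₂ (⊥-elim ∘ r≉0) (≈0⊎≈1 r)

    onSameAxis⇒≈ : ∀ {s u v} → OnAxis s u → OnAxis s v → u ≈⋈ v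
    onSameAxis⇒≈ (onFirst fst-u≉0 snd-u≈0) (onFirst fst-v≉0 snd-v≈0) =
      trans (≉0⇒≈1 fst-u≉0) (sym (≉0⇒≈1 fst-v≉0)) , trans snd-u≈0 (sym snd-v≈0)
    onSameAxis⇒≈ (onSecond fst-u≈0 snd-u≉0) (onSecond fst-v≈0 snd-v≉0) =
      trans fst-u≈0 (sym fst-v≈0) , trans (≉0⇒≈1 snd-u≉0) (sym (≉0⇒≈1 snd-v≉0))

    girth≡∞ : GirthIsInfinite
    girth≡∞ 0 record { length≥3 = () }
    girth≡∞ 1 record { length≥3 = s≤s () }
    girth≡∞ (suc (suc k)) C =
      let s , v₀∈s = vertex⇒onAxis (vertex 0F) (proj₁ (step 0F))
          v₂∈s = path⇒onSameAxis (vertex 0F) (vertex 1F) (vertex 2F) v₀∈s (step 0F) (step 1F)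
      in 0≢2 (distinct 0F 2F (onSameAxis⇒≈ v₀∈s v₂∈s))
      where
      open Cycle C
      0≢2 : ¬ Fin.zero {suc (suc k)} ≡ 2F
      0≢2 ()

  two-element⇒R≅ℤ₂ : (∃[ x ] ∃[ y ] (x ∈I × y ∈I × ¬ (x ≈ y) × (∀ z → z ∈I → (z ≈ x) ⊎ (z ≈ y)))) →
                     (∀ r → r ∈I) ×
                     (∃[ f ] RingMorphisms.IsRingIsomorphism rawRing (CommutativeRing.rawRing xor-∧-commutativeRing) f) ×
                     GirthIsInfinite
  two-element⇒R≅ℤ₂ two-element with two-element⇒⊆[0,a] two-element
  ... | a , a∈I , a≉0 , ⊆[0,a] = every∈I , (toBool , toBool-isRingIsomorphism) , girth≡∞ ≈0⊎≈1
    where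
    a≈1 : a ≈ 1#
    a≈1 = ⊆[0,a]⇒a≈1 D a∈I a≉0 ⊆[0,a]

    every∈I : ∀ r → r ∈I
    every∈I r = respects (trans (*-congˡ a≈1) (*-identityʳ r)) (*-closed r a∈I)

    ≈0⊎≈1 : ∀ r → r ≈ 0# ⊎ r ≈ 1#
    ≈0⊎≈1 r = map₂ (λ r≈a → trans r≈a a≈1) (⊆[0,a] r (every∈I r))

    open TwoElementRing R 1≉0 ≈0⊎≈1

proposition3p2 : ∀ {c ℓ p} (R : CommutativeRing c ℓ) → IsIntegralDomain R → (I : Ideal R p) →
    let open CommutativeRing R
        open Ideal I
        open AmalgamatedDuplication R I
    in ((∃[ x ] ∃[ y ] ∃[ z ] (x ∈I × y ∈I × z ∈I × ¬ (x ≈ y) × ¬ (x ≈ z) × ¬ (y ≈ z)))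
          → Γ.GirthIs4)
       × ((∃[ x ] ∃[ y ] (x ∈I × y ∈I × ¬ (x ≈ y) × (∀ z → z ∈I → (z ≈ x) ⊎ (z ≈ y))))
          → (∀ r → r ∈I)
            × (∃[ f ] RingMorphisms.IsRingIsomorphism (CommutativeRing.rawRing R) (CommutativeRing.rawRing xor-∧-commutativeRing) f)
            × Γ.GirthIsInfinite)
proposition3p2 R D I = three-distinct⇒girth≡4 , two-element⇒R≅ℤ₂
  where open DuplicationOfDomain R D I
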